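{- Let $\mathcal F$ be a $(G,[k_1,\dots,k_t],\lambda)$ Hadamard partitioned difference family. Then (i) $k_1+\cdots+k_t=2\lambda$; (ii) $k_1^2+\cdots+k_t^2=\lambda(2\lambda+1)$; (iii) $\lambda$ is even, and hence $|G|\equiv 0 \pmod 4$.
   Context: Groups are finite, written additively (not necessarily abelian). For $B\subseteq G$, $\Delta B=\{x-y: x,y\in B, x\neq y\}$ as a multiset; for $\mathcal F=\{B_1,\dots,B_t\}$, $\Delta \mathcal F$ is the multiset union of the $\Delta B_i$. A $(G,[k_1,\dots,k_t],\lambda)$ partitioned difference family (PDF) is a partition of $G$ into blocks $B_1,\dots,B_t$ with $|B_i|=k_i$ such that $\Delta\mathcal F$ covers every non-zero element of $G$ exactly $\lambda$ times. It is Hadamard (HPDF) if $|G|=2\lambda$. -}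

module Defs where

open import Data.Nat using (ℕ; _≤_; _*_)
open import Data.Fin using (Fin)
open import Data.Fin.Properties using (_≟_)
open import Data.List using (List; length; filter; cartesianProduct; allFin; map)
open import Data.Nat.ListAction using (sum)
open import Data.Product using (_×_; _,_)
open import Relation.Binary.PropositionalEquality using (_≡_; _≢_)
open import Relation.Nullary using (¬?)
open import Relation.Nullary.Decidable using (_×-dec_)
open import Algebra.Structures using (IsGroup)

-- A finite group of order n, written additively, not necessarily abelian:
-- the carrier is Fin n (an arbitrary enumeration of the elements) with
-- propositional equality.
record FinGroup (n : ℕ) : Set where
  infixl 6 _+_
  field
    _+_     : Fin n → Fin n → Fin n
    0#      : Fin n
    -_      : Fin n → Fin n
    isGroup : IsGroup _≡_ _+_ 0# -_

  _-_ : Fin n → Fin n → Fin n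
  x - y = x + (- y)

-- A partition of G into blocks B_1..B_t is given by the map blk sending each
-- element of G to the (index of the) unique block containing it.
-- Block i is { g | blk g ≡ i }.

blockSize : ∀ {n t} → (Fin n → Fin t) → Fin t → ℕ
blockSize {n} blk i = length (filter (λ g → blk g ≟ i) (allFin n))

diffMult : ∀ {n t} → FinGroup n → (Fin n → Fin t) → Fin n → ℕ
diffMult {n} G blk x =
  length (filter (λ p → let a = Data.Product.proj₁ p ; b = Data.Product.proj₂ p in
                        ((blk a ≟ blk b) ×-dec ¬? (a ≟ b)) ×-dec (a - b ≟ x))
                 (cartesianProduct (allFin n) (allFin n)))
  where open FinGroup G

record IsPDF {n : ℕ} (G : FinGroup n) (t : ℕ) (k : Fin t → ℕ) (λ' : ℕ)
             (blk : Fin n → Fin t) : Set where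
  field
    blockSizes : ∀ i → blockSize blk i ≡ k i
    nonempty   : ∀ i → 1 ≤ k i
    differences : ∀ x → x ≢ FinGroup.0# G → diffMult G blk x ≡ λ'

record IsHPDF {n : ℕ} (G : FinGroup n) (t : ℕ) (k : Fin t → ℕ) (λ' : ℕ)
              (blk : Fin n → Fin t) : Set where
  field
    isPDF    : IsPDF G t k λ' blk
    hadamard : n ≡ 2 * λ'

Σ[_] : ∀ {t} → (Fin t → ℕ) → ℕ
Σ[_] {t} f = sum (map f (allFin t))

module Submission where

-- Double counting of ordered pairs (a , b) lying in a common block: there are
-- Σ kᵢ² of them, namely the |G| diagonal pairs and one pair for each element
-- of ΔF. As 0 is never a difference, ΔF has λ(|G| − 1) elements, so
-- Σ kᵢ² = λ(|G| − 1) + |G| for every PDF; with |G| = Σ kᵢ = 2λ this is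
-- λ(2λ + 1). Finally kᵢ² ≡ kᵢ (mod 2) gives λ(2λ + 1) ≡ 2λ, i.e. λ is even.

open import Defs
open import Algebra.Properties.Group using (x∙y⁻¹≈ε⇒x≈y)
open import Data.Bool using (Bool; true; false; _∧_; not)
open import Data.Bool.Properties using (∧-zeroʳ; ∧-identityʳ)
open import Data.Fin using (Fin; zero; suc)
open import Data.Fin.Properties using (_≟_)
open import Data.List using (List; []; _∷_; _++_; map; filter; length; cartesianProduct; allFin; tabulate)
open import Data.List.Properties using (map-tabulate; map-++; map-∘)
open import Data.Nat using (ℕ; zero; suc; _+_; _*_)
open import Data.Nat.Divisibility using (_∣_; divides; ∣m∣n⇒∣m+n; ∣m+n∣m⇒∣n; m∣m*n; *-monoʳ-∣)
open import Data.Nat.ListAction using () renaming (sum to sumᴸ)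
open import Data.Nat.ListAction.Properties using (sum-++)
open import Data.Nat.Properties using (+-*-semiring; +-identityʳ; *-comm; *-identityʳ; *-zeroʳ; +-cancelʳ-≡)
open import Data.Nat.Solver using (module +-*-Solver)
open import Data.Product using (_×_; _,_)
open import Function using (_∘_)
open import Relation.Binary.PropositionalEquality using (_≡_; refl; sym; trans; cong; cong₂; subst; module ≡-Reasoning)
open import Relation.Nullary using (yes; no; does; contradiction)
open import Relation.Unary using (Pred; Decidable)

open import Algebra.Properties.Semiring.Sum +-*-semiring
  using (sum-syntax; sum-cong-≗; ∑-distrib-+; ∑-comm; *-distribˡ-sum; *-distribʳ-sum)
open +-*-Solver using (solve; _:+_; _:*_; con; _:=_)
open ≡-Reasoning

𝟙 : Bool → ℕ
𝟙 true  = 1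
𝟙 false = 0

𝟙-∧ : ∀ a b → 𝟙 (a ∧ b) ≡ 𝟙 a * 𝟙 b
𝟙-∧ true  b = sym (+-identityʳ (𝟙 b))
𝟙-∧ false b = refl

length-filter≡sum-𝟙 : ∀ {a p} {A : Set a} {P : Pred A p} (P? : Decidable P) (xs : List A) →
                      length (filter P? xs) ≡ sumᴸ (map (λ x → 𝟙 (does (P? x))) xs)
length-filter≡sum-𝟙 P? []       = refl
length-filter≡sum-𝟙 P? (x ∷ xs) with does (P? x)
... | true  = cong suc (length-filter≡sum-𝟙 P? xs)
... | false = length-filter≡sum-𝟙 P? xs

sum-tabulate : ∀ {n} (f : Fin n → ℕ) → sumᴸ (tabulate f) ≡ ∑[ i < n ] f i
sum-tabulate {zero}  f = refl
sum-tabulate {suc n} f = cong (f zero +_) (sum-tabulate (f ∘ suc))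

sum-map-allFin : ∀ {n} (f : Fin n → ℕ) → sumᴸ (map f (allFin n)) ≡ ∑[ i < n ] f i
sum-map-allFin f = trans (cong sumᴸ (map-tabulate (λ i → i) f)) (sum-tabulate f)

sum-map-cartesianProduct : ∀ {a b} {A : Set a} {B : Set b} (f : A × B → ℕ) (xs : List A) (ys : List B) →
  sumᴸ (map f (cartesianProduct xs ys)) ≡ sumᴸ (map (λ x → sumᴸ (map (λ y → f (x , y)) ys)) xs)
sum-map-cartesianProduct f []       ys = refl
sum-map-cartesianProduct f (x ∷ xs) ys = begin
  sumᴸ (map f (map (x ,_) ys ++ cartesianProduct xs ys))
    ≡⟨ cong sumᴸ (map-++ f (map (x ,_) ys) _) ⟩
  sumᴸ (map f (map (x ,_) ys) ++ map f (cartesianProduct xs ys))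
    ≡⟨ sum-++ (map f (map (x ,_) ys)) _ ⟩
  sumᴸ (map f (map (x ,_) ys)) + sumᴸ (map f (cartesianProduct xs ys))
    ≡⟨ cong₂ _+_ (cong sumᴸ (sym (map-∘ ys))) (sum-map-cartesianProduct f xs ys) ⟩
  sumᴸ (map (λ y → f (x , y)) ys) + sumᴸ (map (λ x → sumᴸ (map (λ y → f (x , y)) ys)) xs) ∎

count-allFin : ∀ {n p} {P : Pred (Fin n) p} (P? : Decidable P) →
               length (filter P? (allFin n)) ≡ ∑[ i < n ] 𝟙 (does (P? i))
count-allFin P? = trans (length-filter≡sum-𝟙 P? (allFin _)) (sum-map-allFin (λ i → 𝟙 (does (P? i))))

count-allFin² : ∀ {m n p} {P : Pred (Fin m × Fin n) p} (P? : Decidable P) →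
                length (filter P? (cartesianProduct (allFin m) (allFin n)))
                  ≡ ∑[ a < m ] ∑[ b < n ] 𝟙 (does (P? (a , b)))
count-allFin² {m} {n} P? = begin
  length (filter P? (cartesianProduct (allFin m) (allFin n)))
    ≡⟨ length-filter≡sum-𝟙 P? (cartesianProduct (allFin m) (allFin n)) ⟩
  sumᴸ (map (λ x → 𝟙 (does (P? x))) (cartesianProduct (allFin m) (allFin n)))
    ≡⟨ sum-map-cartesianProduct (λ x → 𝟙 (does (P? x))) (allFin m) (allFin n) ⟩
  sumᴸ (map (λ a → sumᴸ (map (λ b → 𝟙 (does (P? (a , b)))) (allFin n))) (allFin m))
    ≡⟨ sum-map-allFin (λ a → sumᴸ (map (λ b → 𝟙 (does (P? (a , b)))) (allFin n))) ⟩
  ∑[ a < m ] sumᴸ (map (λ b → 𝟙 (does (P? (a , b)))) (allFin n))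
    ≡⟨ sum-cong-≗ (λ a → sum-map-allFin (λ b → 𝟙 (does (P? (a , b))))) ⟩
  ∑[ a < m ] ∑[ b < n ] 𝟙 (does (P? (a , b))) ∎

∑-const : ∀ n c → ∑[ i < n ] c ≡ n * c
∑-const zero    c = refl
∑-const (suc n) c = cong (c +_) (∑-const n c)

∑-0 : ∀ n → ∑[ i < n ] 0 ≡ 0
∑-0 n = trans (∑-const n 0) (*-zeroʳ n)

∑-1 : ∀ n → ∑[ i < n ] 1 ≡ n
∑-1 n = trans (∑-const n 1) (*-identityʳ n)

∑∑-* : ∀ {m n} (f : Fin m → ℕ) (g : Fin n → ℕ) →
       ∑[ a < m ] ∑[ b < n ] (f a * g b) ≡ (∑[ a < m ] f a) * (∑[ b < n ] g b)
∑∑-* {m} {n} f g = begin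
  ∑[ a < m ] ∑[ b < n ] (f a * g b)    ≡⟨ sum-cong-≗ (λ a → sym (*-distribˡ-sum (f a) g)) ⟩
  ∑[ a < m ] (f a * ∑[ b < n ] g b)    ≡⟨ sym (*-distribʳ-sum (∑[ b < n ] g b) f) ⟩
  (∑[ a < m ] f a) * (∑[ b < n ] g b)  ∎

δ : ∀ {n} → Fin n → Fin n → ℕ
δ i j = 𝟙 (does (i ≟ j))

δ-refl : ∀ {n} (i : Fin n) → δ i i ≡ 1
δ-refl i with i ≟ i
... | yes _   = refl
... | no  i≢i = contradiction refl i≢i

∑-δ-* : ∀ {n} (i : Fin n) (f : Fin n → ℕ) → ∑[ j < n ] (δ i j * f j) ≡ f i
∑-δ-* {suc n} zero    f =
  trans (cong₂ _+_ (+-identityʳ (f zero)) (∑-0 n)) (+-identityʳ (f zero))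
∑-δ-* {suc n} (suc i) f = ∑-δ-* i (f ∘ suc)

∑-δ : ∀ {n} (i : Fin n) → ∑[ j < n ] δ i j ≡ 1
∑-δ i = trans (sum-cong-≗ (λ j → sym (*-identityʳ (δ i j)))) (∑-δ-* i (λ _ → 1))

module BlockCounts {n t} (blk : Fin n → Fin t) where

  blockSize≡∑ : ∀ i → blockSize blk i ≡ ∑[ g < n ] δ (blk g) i
  blockSize≡∑ i = count-allFin (λ g → blk g ≟ i)

  sameBlockDistinct : Fin n → Fin n → Bool
  sameBlockDistinct a b = does (blk a ≟ blk b) ∧ not (does (a ≟ b))

  sameBlockDistinct+δ : ∀ a b → 𝟙 (sameBlockDistinct a b) + δ a b ≡ δ (blk a) (blk b)
  sameBlockDistinct+δ a b with a ≟ b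
  ... | yes refl = trans (cong (λ c → 𝟙 c + 1) (∧-zeroʳ (does (blk a ≟ blk a)))) (sym (δ-refl (blk a)))
  ... | no  _    = trans (+-identityʳ _) (cong 𝟙 (∧-identityʳ (does (blk a ≟ blk b))))

  ∑-blockSize : ∑[ i < t ] blockSize blk i ≡ n
  ∑-blockSize = begin
    ∑[ i < t ] blockSize blk i          ≡⟨ sum-cong-≗ blockSize≡∑ ⟩
    ∑[ i < t ] ∑[ g < n ] δ (blk g) i   ≡⟨ ∑-comm (λ i g → δ (blk g) i) ⟩
    ∑[ g < n ] ∑[ i < t ] δ (blk g) i   ≡⟨ sum-cong-≗ (λ g → ∑-δ (blk g)) ⟩
    ∑[ g < n ] 1                        ≡⟨ ∑-1 n ⟩
    n                                   ∎

  ∑-sameBlock≡∑-blockSize² :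
    ∑[ a < n ] ∑[ b < n ] δ (blk a) (blk b) ≡ ∑[ i < t ] (blockSize blk i * blockSize blk i)
  ∑-sameBlock≡∑-blockSize² = begin
    ∑[ a < n ] ∑[ b < n ] δ (blk a) (blk b)
      ≡⟨ ∑-comm (λ a b → δ (blk a) (blk b)) ⟩
    ∑[ a < n ] ∑[ b < n ] δ (blk b) (blk a)
      ≡⟨ sum-cong-≗ (λ a → sum-cong-≗ (λ b → sym (∑-δ-* (blk a) (δ (blk b))))) ⟩
    ∑[ a < n ] ∑[ b < n ] ∑[ i < t ] (δ (blk a) i * δ (blk b) i)
      ≡⟨ sum-cong-≗ (λ a → ∑-comm (λ b i → δ (blk a) i * δ (blk b) i)) ⟩
    ∑[ a < n ] ∑[ i < t ] ∑[ b < n ] (δ (blk a) i * δ (blk b) i)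
      ≡⟨ ∑-comm (λ a i → ∑[ b < n ] (δ (blk a) i * δ (blk b) i)) ⟩
    ∑[ i < t ] ∑[ a < n ] ∑[ b < n ] (δ (blk a) i * δ (blk b) i)
      ≡⟨ sum-cong-≗ (λ i → ∑∑-* (λ a → δ (blk a) i) (λ b → δ (blk b) i)) ⟩
    ∑[ i < t ] ((∑[ g < n ] δ (blk g) i) * (∑[ g < n ] δ (blk g) i))
      ≡⟨ sum-cong-≗ (λ i → sym (cong₂ _*_ (blockSize≡∑ i) (blockSize≡∑ i))) ⟩
    ∑[ i < t ] (blockSize blk i * blockSize blk i) ∎

  ∑-sameBlock≡∑-sameBlockDistinct+n :
    ∑[ a < n ] ∑[ b < n ] δ (blk a) (blk b) ≡ ∑[ a < n ] ∑[ b < n ] 𝟙 (sameBlockDistinct a b) + n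
  ∑-sameBlock≡∑-sameBlockDistinct+n = begin
    ∑[ a < n ] ∑[ b < n ] δ (blk a) (blk b)
      ≡⟨ sum-cong-≗ (λ a → sum-cong-≗ (λ b → sym (sameBlockDistinct+δ a b))) ⟩
    ∑[ a < n ] ∑[ b < n ] (𝟙 (sameBlockDistinct a b) + δ a b)
      ≡⟨ sum-cong-≗ (λ a → ∑-distrib-+ (λ b → 𝟙 (sameBlockDistinct a b)) (δ a)) ⟩
    ∑[ a < n ] (∑[ b < n ] 𝟙 (sameBlockDistinct a b) + ∑[ b < n ] δ a b)
      ≡⟨ ∑-distrib-+ (λ a → ∑[ b < n ] 𝟙 (sameBlockDistinct a b)) (λ a → ∑[ b < n ] δ a b) ⟩
    ∑[ a < n ] ∑[ b < n ] 𝟙 (sameBlockDistinct a b) + ∑[ a < n ] ∑[ b < n ] δ a b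
      ≡⟨ cong (∑[ a < n ] ∑[ b < n ] 𝟙 (sameBlockDistinct a b) +_) (trans (sum-cong-≗ (∑-δ {n})) (∑-1 n)) ⟩
    ∑[ a < n ] ∑[ b < n ] 𝟙 (sameBlockDistinct a b) + n ∎

module DifferenceCounts {n t} (G : FinGroup n) (blk : Fin n → Fin t) where
  open FinGroup G
  open BlockCounts blk

  diffMult≡∑ : ∀ x → diffMult G blk x ≡ ∑[ a < n ] ∑[ b < n ] (𝟙 (sameBlockDistinct a b) * δ (a - b) x)
  diffMult≡∑ x = trans (count-allFin² {n} {n} _)
    (sum-cong-≗ (λ a → sum-cong-≗ (λ b → 𝟙-∧ (sameBlockDistinct a b) (does (a - b ≟ x)))))

  ∑-diffMult : ∑[ x < n ] diffMult G blk x ≡ ∑[ a < n ] ∑[ b < n ] 𝟙 (sameBlockDistinct a b)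
  ∑-diffMult = begin
    ∑[ x < n ] diffMult G blk x
      ≡⟨ sum-cong-≗ diffMult≡∑ ⟩
    ∑[ x < n ] ∑[ a < n ] ∑[ b < n ] (s a b * δ (a - b) x)
      ≡⟨ ∑-comm (λ x a → ∑[ b < n ] (s a b * δ (a - b) x)) ⟩
    ∑[ a < n ] ∑[ x < n ] ∑[ b < n ] (s a b * δ (a - b) x)
      ≡⟨ sum-cong-≗ (λ a → ∑-comm (λ x b → s a b * δ (a - b) x)) ⟩
    ∑[ a < n ] ∑[ b < n ] ∑[ x < n ] (s a b * δ (a - b) x)
      ≡⟨ sum-cong-≗ (λ a → sum-cong-≗ (λ b → sym (*-distribˡ-sum (s a b) (δ (a - b))))) ⟩
    ∑[ a < n ] ∑[ b < n ] (s a b * ∑[ x < n ] δ (a - b) x)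
      ≡⟨ sum-cong-≗ (λ a → sum-cong-≗ (λ b → trans (cong (s a b *_) (∑-δ (a - b))) (*-identityʳ (s a b)))) ⟩
    ∑[ a < n ] ∑[ b < n ] s a b ∎
    where
    s : Fin n → Fin n → ℕ
    s a b = 𝟙 (sameBlockDistinct a b)

  -≡0#⇒≡ : ∀ {a b} → a - b ≡ 0# → a ≡ b
  -≡0#⇒≡ = x∙y⁻¹≈ε⇒x≈y (record { isGroup = isGroup }) _ _

  diffMult-0# : diffMult G blk 0# ≡ 0
  diffMult-0# = trans (diffMult≡∑ 0#)
    (trans (sum-cong-≗ (λ a → trans (sum-cong-≗ (sameBlockDistinct*δ0#≡0 a)) (∑-0 n))) (∑-0 n))
    where
    sameBlockDistinct*δ0#≡0 : ∀ a b → 𝟙 (sameBlockDistinct a b) * δ (a - b) 0# ≡ 0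
    sameBlockDistinct*δ0#≡0 a b with a - b ≟ 0#
    ... | no  _      = *-zeroʳ (𝟙 (sameBlockDistinct a b))
    ... | yes a-b≡0# with a ≟ b
    ...   | yes _   = cong (λ c → 𝟙 c * 1) (∧-zeroʳ (does (blk a ≟ blk b)))
    ...   | no  a≢b = contradiction (-≡0#⇒≡ a-b≡0#) a≢b

module PDFCounts {n t k λ'} {G : FinGroup n} {blk : Fin n → Fin t} (pdf : IsPDF G t k λ' blk) where
  open IsPDF pdf
  open FinGroup G using (0#)
  open BlockCounts blk
  open DifferenceCounts G blk

  ∑-k≡n : ∑[ i < t ] k i ≡ n
  ∑-k≡n = trans (sym (sum-cong-≗ blockSizes)) ∑-blockSize

  ∑-diffMult+λ≡λ*n : ∑[ x < n ] diffMult G blk x + λ' ≡ λ' * n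
  ∑-diffMult+λ≡λ*n = begin
    ∑[ x < n ] diffMult G blk x + λ'
      ≡⟨ cong (∑[ x < n ] diffMult G blk x +_) (trans (sym (*-identityʳ λ')) (cong (λ' *_) (sym (∑-δ 0#)))) ⟩
    ∑[ x < n ] diffMult G blk x + λ' * ∑[ x < n ] δ 0# x
      ≡⟨ cong (∑[ x < n ] diffMult G blk x +_) (*-distribˡ-sum λ' (δ 0#)) ⟩
    ∑[ x < n ] diffMult G blk x + ∑[ x < n ] (λ' * δ 0# x)
      ≡⟨ sym (∑-distrib-+ (diffMult G blk) (λ x → λ' * δ 0# x)) ⟩
    ∑[ x < n ] (diffMult G blk x + λ' * δ 0# x)
      ≡⟨ sum-cong-≗ diffMult+λδ≡λ ⟩
    ∑[ x < n ] λ'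
      ≡⟨ trans (∑-const n λ') (*-comm n λ') ⟩
    λ' * n ∎
    where
    diffMult+λδ≡λ : ∀ x → diffMult G blk x + λ' * δ 0# x ≡ λ'
    diffMult+λδ≡λ x with 0# ≟ x
    ... | yes refl = trans (cong (_+ λ' * 1) diffMult-0#) (*-identityʳ λ')
    ... | no  0≢x  = trans (cong₂ _+_ (differences x (0≢x ∘ sym)) (*-zeroʳ λ')) (+-identityʳ λ')

  ∑-k²+λ≡λ*n+n : ∑[ i < t ] (k i * k i) + λ' ≡ λ' * n + n
  ∑-k²+λ≡λ*n+n = begin
    ∑[ i < t ] (k i * k i) + λ'
      ≡⟨ cong (_+ λ') (sym (sum-cong-≗ (λ i → cong₂ _*_ (blockSizes i) (blockSizes i)))) ⟩
    ∑[ i < t ] (blockSize blk i * blockSize blk i) + λ'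
      ≡⟨ cong (_+ λ') (sym ∑-sameBlock≡∑-blockSize²) ⟩
    ∑[ a < n ] ∑[ b < n ] δ (blk a) (blk b) + λ'
      ≡⟨ cong (_+ λ') (trans ∑-sameBlock≡∑-sameBlockDistinct+n (cong (_+ n) (sym ∑-diffMult))) ⟩
    D + n + λ'
      ≡⟨ solve 3 (λ D n l → D :+ n :+ l := D :+ l :+ n) refl D n λ' ⟩
    D + λ' + n
      ≡⟨ cong (_+ n) ∑-diffMult+λ≡λ*n ⟩
    λ' * n + n ∎
    where
    D : ℕ
    D = ∑[ x < n ] diffMult G blk x

2∣n*n+n : ∀ n → 2 ∣ n * n + n
2∣n*n+n zero    = divides 0 refl
2∣n*n+n (suc n) = subst (2 ∣_)
  (solve 1 (λ n → n :* n :+ n :+ con 2 :* (con 1 :+ n) := (con 1 :+ n) :* (con 1 :+ n) :+ (con 1 :+ n)) refl n)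
  (∣m∣n⇒∣m+n (2∣n*n+n n) (m∣m*n (suc n)))

∣-∑ : ∀ {d n} (f : Fin n → ℕ) → (∀ i → d ∣ f i) → d ∣ ∑[ i < n ] f i
∣-∑ {n = zero}  f d∣f = divides 0 refl
∣-∑ {n = suc n} f d∣f = ∣m∣n⇒∣m+n (d∣f zero) (∣-∑ (f ∘ suc) (d∣f ∘ suc))

2∣∑-*+∑ : ∀ {n} (f : Fin n → ℕ) → 2 ∣ ∑[ i < n ] (f i * f i) + ∑[ i < n ] f i
2∣∑-*+∑ f = subst (2 ∣_) (∑-distrib-+ (λ i → f i * f i) f) (∣-∑ (λ i → f i * f i + f i) (λ i → 2∣n*n+n (f i)))

proposition3p1 : (n : ℕ) (G : FinGroup n) (t : ℕ) (k : Fin t → ℕ) (λ' : ℕ) (blk : Fin n → Fin t) →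
    IsHPDF G t k λ' blk →
    (Σ[ k ] ≡ 2 * λ') × (Σ[ (λ i → k i * k i) ] ≡ λ' * (2 * λ' + 1)) × (2 ∣ λ') × (4 ∣ n)
proposition3p1 n G t k λ' blk hpdf =
    trans (sum-map-allFin k) ∑k≡2λ
  , trans (sum-map-allFin (λ i → k i * k i)) ∑k²≡λ[2λ+1]
  , 2∣λ
  , subst (4 ∣_) (sym hadamard) (*-monoʳ-∣ 2 2∣λ)
  where
  open IsHPDF hpdf
  open PDFCounts isPDF

  ∑k≡2λ : ∑[ i < t ] k i ≡ 2 * λ'
  ∑k≡2λ = trans ∑-k≡n hadamard

  ∑k²≡λ[2λ+1] : ∑[ i < t ] (k i * k i) ≡ λ' * (2 * λ' + 1)
  ∑k²≡λ[2λ+1] = +-cancelʳ-≡ λ' _ _ (begin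
    ∑[ i < t ] (k i * k i) + λ'  ≡⟨ ∑-k²+λ≡λ*n+n ⟩
    λ' * n + n                   ≡⟨ cong (λ m → λ' * m + m) hadamard ⟩
    λ' * (2 * λ') + 2 * λ'       ≡⟨ solve 1 (λ l → l :* (con 2 :* l) :+ con 2 :* l := l :* (con 2 :* l :+ con 1) :+ l) refl λ' ⟩
    λ' * (2 * λ' + 1) + λ'       ∎)

  2∣λ : 2 ∣ λ'
  2∣λ = ∣m+n∣m⇒∣n (subst (2 ∣_) ∑k²+∑k≡2[λ*λ+λ]+λ (2∣∑-*+∑ k)) (m∣m*n (λ' * λ' + λ'))
    where
    ∑k²+∑k≡2[λ*λ+λ]+λ : ∑[ i < t ] (k i * k i) + ∑[ i < t ] k i ≡ 2 * (λ' * λ' + λ') + λ'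
    ∑k²+∑k≡2[λ*λ+λ]+λ = trans (cong₂ _+_ ∑k²≡λ[2λ+1] ∑k≡2λ)
      (solve 1 (λ l → l :* (con 2 :* l :+ con 1) :+ con 2 :* l := con 2 :* (l :* l :+ l) :+ l) refl λ')
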